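{- Let $V$ be a set of points in the plane in general position (no three collinear). Let $T_1$ and $T_2$ be two triangles whose vertices are points of $V$ and which share at most one vertex. Then among the six edges (straight-line segments) of $T_1$ and $T_2$ there are two edges that are disjoint as closed segments.
   Context: Edges of a triangle with vertices in $V$ are the closed straight-line segments joining pairs of its vertices; two segments are disjoint if they have no point in common (neither a common endpoint nor a crossing). -}

module Defs where

open import Level using (0ℓ)
open import Data.Product using (Σ; ∃; _×_; _,_)
open import Data.List using (List; _∷_; [])
open import Data.List.Membership.Propositional using (_∈_)
open import Relation.Nullary using (¬_)
open import Relation.Binary.PropositionalEquality using (_≡_; _≢_)
open import Relation.Binary.Structures using (IsTotalOrder)
open import Algebra.Structures using (IsCommutativeRing)

-- An ordered field (with propositional equality).  The real numbers are an
-- instance; the plane is Carrier × Carrier.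
record OrderedField : Set₁ where
  infixl 6 _+_ _-_
  infixl 7 _*_
  infix 4 _≤_
  field
    Carrier : Set
    _+_ _*_ : Carrier → Carrier → Carrier
    -_ : Carrier → Carrier
    0# 1# : Carrier
    _≤_ : Carrier → Carrier → Set
    isCommutativeRing : IsCommutativeRing _≡_ _+_ _*_ -_ 0# 1#
    0≢1 : 0# ≢ 1#
    _⁻¹ : Carrier → Carrier
    ⁻¹-inverse : ∀ x → x ≢ 0# → x * (x ⁻¹) ≡ 1#
    isTotalOrder : IsTotalOrder _≡_ _≤_
    +-mono-≤ : ∀ x y z → x ≤ y → x + z ≤ y + z
    *-nonneg : ∀ x y → 0# ≤ x → 0# ≤ y → 0# ≤ x * y

  _-_ : Carrier → Carrier → Carrier
  x - y = x + (- y)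

module Plane (F : OrderedField) where
  open OrderedField F

  Point : Set
  Point = Carrier × Carrier

  x-coord y-coord : Point → Carrier
  x-coord (x , _) = x
  y-coord (_ , y) = y

  Collinear : Point → Point → Point → Set
  Collinear p q r =
    (x-coord q - x-coord p) * (y-coord r - y-coord p)
      - (y-coord q - y-coord p) * (x-coord r - x-coord p) ≡ 0#

  GeneralPosition : (Point → Set) → Set
  GeneralPosition V = ∀ p q r → V p → V q → V r →
    p ≢ q → q ≢ r → p ≢ r → ¬ Collinear p q r

  OnSegment : Point → Point → Point → Set
  OnSegment a b z = ∃ λ t → (0# ≤ t) × (t ≤ 1#) ×
    (x-coord z ≡ x-coord a + t * (x-coord b - x-coord a)) ×
    (y-coord z ≡ y-coord a + t * (y-coord b - y-coord a))

  Segment : Set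
  Segment = Point × Point

  Disjoint : Segment → Segment → Set
  Disjoint (a , b) (c , d) = ∀ z → OnSegment a b z → OnSegment c d z → ⊥'
    where open import Data.Empty renaming (⊥ to ⊥')

  record Triangle (V : Point → Set) : Set where
    constructor triangle
    field
      a b c : Point
      a∈V : V a
      b∈V : V b
      c∈V : V c
      a≢b : a ≢ b
      b≢c : b ≢ c
      a≢c : a ≢ c

    vertices : List Point
    vertices = a ∷ b ∷ c ∷ []

    edges : List Segment
    edges = (a , b) ∷ (b , c) ∷ (a , c) ∷ []

  ShareAtMostOneVertex : ∀ {V} → Triangle V → Triangle V → Set
  ShareAtMostOneVertex T₁ T₂ = ∀ x y →
    x ∈ Triangle.vertices T₁ → x ∈ Triangle.vertices T₂ →
    y ∈ Triangle.vertices T₁ → y ∈ Triangle.vertices T₂ → x ≡ y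

module Submission where

-- Write orient a b z for the orientation determinant of
-- (a, b, z); it is zero on the segment [a,b] and, restricted to a segment
-- [c,d], it is affine in the segment parameter.  So if c and d lie strictly
-- on the same side of the line ab, every point of [c,d] has orient a b ≠ 0,
-- and [a,b] and [c,d] are disjoint.  Now, as the triangles share at most
-- one vertex, some edge xy of T₁ has neither endpoint among the vertices
-- p, q, r of T₂; by general position none of p, q, r lies on the line xy,
-- and by pigeonhole two of them lie on the same side of it.  The edge of
-- T₂ joining those two is disjoint from xy.

open import Level using (0ℓ)
open import Algebra.Bundles using (CommutativeRing)
open import Data.Product using (∃; ∃₂; _×_; _,_; proj₁)
open import Data.Sum using (_⊎_; inj₁; inj₂)
open import Data.Empty using (⊥; ⊥-elim)
open import Data.List using (List; []; _∷_; _++_)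
open import Data.List.Membership.Propositional using (_∈_; _∉_)
open import Data.List.Membership.Propositional.Properties using (∈-++⁺ˡ; ∈-++⁺ʳ)
open import Data.List.Relation.Unary.Any using (here; there)
open import Relation.Nullary using (¬_)
open import Defs

-- A ring solver for any commutative ring, with the integers as
-- coefficients: the standard library's Algebra.Solver.Ring instantiated along
-- the canonical ring homomorphism ℤ → R.
module IntegerCoefficientSolver {c ℓ} (R : CommutativeRing c ℓ) where
  open import Data.Nat as ℕ using (zero; suc)
  import Data.Nat.Properties as ℕ
  open import Data.Integer as ℤ using (ℤ; +_; -[1+_]; _⊖_; _◃_; sign; ∣_∣)
  import Data.Integer.Properties as ℤ
  open import Data.Sign as Sign using (Sign)
  open import Data.Maybe using (Maybe; just; nothing)
  open import Relation.Nullary using (yes; no)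
  import Relation.Binary.PropositionalEquality as ≡
  open import Algebra.Solver.Ring.AlmostCommutativeRing
    using (fromCommutativeRing; _-Raw-AlmostCommutative⟶_)

  open CommutativeRing R
  open import Algebra.Properties.Ring ring
    using (-0#≈0#; -‿distribˡ-*; -‿distribʳ-*; -‿involutive)
  open import Algebra.Properties.AbelianGroup +-abelianGroup using (⁻¹-∙-comm)
  open import Algebra.Properties.CommutativeSemigroup +-commutativeSemigroup
    using () renaming (interchange to +-interchange)
  -- n · x is the n-fold sum of x (with 1 · x = x definitionally)
  open import Algebra.Properties.Monoid.Mult.TCOptimised +-monoid
    using (1+×; ×-homo-+) renaming (_×_ to _·_)
  open import Algebra.Properties.Semiring.Mult.TCOptimised semiring using (×1-homo-*)
  open import Relation.Binary.Reasoning.Setoid setoid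

  ⟦_⟧ℤ : ℤ → Carrier
  ⟦ + n ⟧ℤ      = n · 1#
  ⟦ -[1+ n ] ⟧ℤ = - (suc n · 1#)

  -- negation according to a sign; integer multiplication is sign-times-magnitude
  signed : Sign → Carrier → Carrier
  signed Sign.+ x = x
  signed Sign.- x = - x

  signed-cong : ∀ s {x y} → x ≈ y → signed s x ≈ signed s y
  signed-cong Sign.+ x≈y = x≈y
  signed-cong Sign.- x≈y = -‿cong x≈y

  signed-* : ∀ s t x y → signed (s Sign.* t) (x * y) ≈ signed s x * signed t y
  signed-* Sign.+ Sign.+ x y = refl
  signed-* Sign.+ Sign.- x y = -‿distribʳ-* x y
  signed-* Sign.- Sign.+ x y = -‿distribˡ-* x y
  signed-* Sign.- Sign.- x y = begin
    x * y           ≈⟨ -‿involutive (x * y) ⟨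
    - (- (x * y))   ≈⟨ -‿cong (-‿distribˡ-* x y) ⟩
    - (- x * y)     ≈⟨ -‿distribʳ-* (- x) y ⟩
    - x * - y       ∎

  -- ⟦_⟧ℤ in sign-magnitude form (note that - 0 = 0 in R)
  ⟦◃⟧ : ∀ s n → ⟦ s ◃ n ⟧ℤ ≈ signed s (n · 1#)
  ⟦◃⟧ Sign.+ zero    = refl
  ⟦◃⟧ Sign.- zero    = sym -0#≈0#
  ⟦◃⟧ Sign.+ (suc n) = refl
  ⟦◃⟧ Sign.- (suc n) = refl

  ⟦⟧-sign-abs : ∀ i → ⟦ i ⟧ℤ ≈ signed (sign i) (∣ i ∣ · 1#)
  ⟦⟧-sign-abs (+ n)      = refl
  ⟦⟧-sign-abs -[1+ n ]   = refl

  ⟦⊖⟧ : ∀ m n → ⟦ m ⊖ n ⟧ℤ ≈ m · 1# - n · 1#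
  ⟦⊖⟧ zero    zero    = sym (trans (+-identityˡ _) -0#≈0#)
  ⟦⊖⟧ zero    (suc n) = sym (+-identityˡ _)
  ⟦⊖⟧ (suc m) zero    = sym (trans (+-congˡ -0#≈0#) (+-identityʳ _))
  ⟦⊖⟧ (suc m) (suc n) = begin
    ⟦ suc m ⊖ suc n ⟧ℤ        ≡⟨ ≡.cong ⟦_⟧ℤ (ℤ.[1+m]⊖[1+n]≡m⊖n m n) ⟩
    ⟦ m ⊖ n ⟧ℤ                ≈⟨ ⟦⊖⟧ m n ⟩
    M - N                      ≈⟨ +-identityˡ (M - N) ⟨
    0# + (M - N)               ≈⟨ +-congʳ (-‿inverseʳ 1#) ⟨
    (1# - 1#) + (M - N)        ≈⟨ +-interchange 1# (- 1#) M (- N) ⟩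
    (1# + M) + (- 1# - N)      ≈⟨ +-congˡ (⁻¹-∙-comm 1# N) ⟩
    (1# + M) - (1# + N)        ≈⟨ +-cong (1+× m 1#) (-‿cong (1+× n 1#)) ⟨
    suc m · 1# - suc n · 1#    ∎
    where
    M = m · 1#
    N = n · 1#

  ⟦⟧-+-homo : ∀ i j → ⟦ i ℤ.+ j ⟧ℤ ≈ ⟦ i ⟧ℤ + ⟦ j ⟧ℤ
  ⟦⟧-+-homo (+ m)      (+ n)      = ×-homo-+ 1# m n
  ⟦⟧-+-homo (+ m)      -[1+ n ]   = ⟦⊖⟧ m (suc n)
  ⟦⟧-+-homo -[1+ m ]   (+ n)      = trans (⟦⊖⟧ n (suc m)) (+-comm _ _)
  ⟦⟧-+-homo -[1+ m ]   -[1+ n ]   = begin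
    - (suc (suc (m ℕ.+ n)) · 1#)   ≡⟨ ≡.cong (λ k → - (k · 1#)) (ℕ.+-suc (suc m) n) ⟨
    - ((suc m ℕ.+ suc n) · 1#)     ≈⟨ -‿cong (×-homo-+ 1# (suc m) (suc n)) ⟩
    - (suc m · 1# + suc n · 1#)    ≈⟨ ⁻¹-∙-comm _ _ ⟨
    - (suc m · 1#) - suc n · 1#    ∎

  ⟦⟧-*-homo : ∀ i j → ⟦ i ℤ.* j ⟧ℤ ≈ ⟦ i ⟧ℤ * ⟦ j ⟧ℤ
  ⟦⟧-*-homo i j = begin
    ⟦ s ◃ ∣ i ∣ ℕ.* ∣ j ∣ ⟧ℤ                ≈⟨ ⟦◃⟧ s (∣ i ∣ ℕ.* ∣ j ∣) ⟩
    signed s ((∣ i ∣ ℕ.* ∣ j ∣) · 1#)       ≈⟨ signed-cong s (×1-homo-* ∣ i ∣ ∣ j ∣) ⟩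
    signed s ((∣ i ∣ · 1#) * (∣ j ∣ · 1#))  ≈⟨ signed-* (sign i) (sign j) _ _ ⟩
    signed (sign i) (∣ i ∣ · 1#) * signed (sign j) (∣ j ∣ · 1#)
                                            ≈⟨ *-cong (⟦⟧-sign-abs i) (⟦⟧-sign-abs j) ⟨
    ⟦ i ⟧ℤ * ⟦ j ⟧ℤ                         ∎
    where s = sign i Sign.* sign j

  ⟦⟧-‿homo : ∀ i → ⟦ ℤ.- i ⟧ℤ ≈ - ⟦ i ⟧ℤ
  ⟦⟧-‿homo (+ zero)    = sym -0#≈0#
  ⟦⟧-‿homo (+ suc n)   = refl
  ⟦⟧-‿homo -[1+ n ]    = sym (-‿involutive _)

  ℤ-homomorphism : ℤ.+-*-rawRing -Raw-AlmostCommutative⟶ fromCommutativeRing R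
  ℤ-homomorphism = record
    { ⟦_⟧    = ⟦_⟧ℤ
    ; +-homo = ⟦⟧-+-homo
    ; *-homo = ⟦⟧-*-homo
    ; -‿homo = ⟦⟧-‿homo
    ; 0-homo = refl
    ; 1-homo = refl
    }

  -- equal integer coefficients have equal images; the solver uses this to
  -- drop zero coefficients from normal forms
  _coeff≟_ : ∀ i j → Maybe (⟦ i ⟧ℤ ≈ ⟦ j ⟧ℤ)
  i coeff≟ j with i ℤ.≟ j
  ... | yes ≡.refl = just refl
  ... | no _       = nothing

  open import Algebra.Solver.Ring ℤ.+-*-rawRing (fromCommutativeRing R) ℤ-homomorphism _coeff≟_
    public using (solve; _:=_; _:+_; _:-_; _:*_; :-_; con)

module OrderedFieldFacts (F : OrderedField) where
  open OrderedField F
  open import Relation.Binary.Structures using (IsTotalOrder)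
  open IsTotalOrder isTotalOrder using (total; antisym)
  open import Relation.Binary.PropositionalEquality
    using (_≡_; _≢_; refl; sym; trans; cong; cong₂; subst; subst₂; module ≡-Reasoning)
  open ≡-Reasoning
  open import Data.Integer using (+_)

  commutativeRing : CommutativeRing 0ℓ 0ℓ
  commutativeRing = record { isCommutativeRing = isCommutativeRing }

  open CommutativeRing commutativeRing
    using (+-identityˡ; +-identityʳ; +-comm; -‿inverseʳ; zeroˡ; *-assoc; *-identityʳ; ring; +-group)
  open import Algebra.Properties.Ring ring using (-0#≈0#; -‿involutive; -1*x≈-x)
  open import Algebra.Properties.Group +-group using (x∙y⁻¹≈ε⇒x≈y)
  open IntegerCoefficientSolver commutativeRing public
    using (solve; _:=_; _:+_; _:-_; _:*_; :-_; con)

  x≤y⇒0≤y-x : ∀ {x y} → x ≤ y → 0# ≤ y - x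
  x≤y⇒0≤y-x {x} {y} x≤y = subst (_≤ y - x) (-‿inverseʳ x) (+-mono-≤ x y (- x) x≤y)

  x≤0⇒0≤-x : ∀ {x} → x ≤ 0# → 0# ≤ - x
  x≤0⇒0≤-x {x} x≤0 = subst (0# ≤_) (+-identityˡ (- x)) (x≤y⇒0≤y-x x≤0)

  -- if 1 ≤ 0 then -1 would be nonnegative, and so would (-1)(-1) = 1
  1≰0 : ¬ (1# ≤ 0#)
  1≰0 1≤0 = 0≢1 (antisym 0≤1 1≤0)
    where
    0≤-1 : 0# ≤ - 1#
    0≤-1 = x≤0⇒0≤-x 1≤0
    0≤1 : 0# ≤ 1#
    0≤1 = subst (0# ≤_) (trans (-1*x≈-x (- 1#)) (-‿involutive 1#)) (*-nonneg _ _ 0≤-1 0≤-1)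

  nonneg-sum≡0 : ∀ {x y} → 0# ≤ x → 0# ≤ y → x + y ≡ 0# → x ≡ 0#
  nonneg-sum≡0 {x} {y} 0≤x 0≤y x+y≡0 = antisym x≤0 0≤x
    where
    x≤0 : x ≤ 0#
    x≤0 = subst₂ _≤_ (+-identityˡ x) (trans (+-comm y x) x+y≡0) (+-mono-≤ 0# y x 0≤y)

  no-zero-divisors : ∀ {u v} → u * v ≡ 0# → v ≢ 0# → u ≡ 0#
  no-zero-divisors {u} {v} uv≡0 v≢0 = begin
    u                ≡⟨ *-identityʳ u ⟨
    u * 1#           ≡⟨ cong (u *_) (⁻¹-inverse v v≢0) ⟨
    u * (v * v ⁻¹)   ≡⟨ *-assoc u v (v ⁻¹) ⟨
    (u * v) * v ⁻¹   ≡⟨ cong (_* v ⁻¹) uv≡0 ⟩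
    0# * v ⁻¹        ≡⟨ zeroˡ (v ⁻¹) ⟩
    0#               ∎

  -- Whether x ≢ 0 is decidable up to double negation: compare e = x x⁻¹
  -- with 1 - e.  If x ≢ 0 then e = 1, so e ≤ 1 - e is impossible; if
  -- x = 0 then e = 0, so 1 - e ≤ e is impossible.
  ≢0⊎¬≢0 : ∀ x → x ≢ 0# ⊎ ¬ x ≢ 0#
  ≢0⊎¬≢0 x with total (x * x ⁻¹) (1# - x * x ⁻¹)
  ... | inj₁ e≤1-e = inj₂ λ x≢0 → 1≰0 (subst₂ _≤_ (⁻¹-inverse x x≢0) (1-e≡0 x≢0) e≤1-e)
    where
    1-e≡0 : x ≢ 0# → 1# - x * x ⁻¹ ≡ 0#
    1-e≡0 x≢0 = trans (cong (λ w → 1# - w) (⁻¹-inverse x x≢0)) (-‿inverseʳ 1#)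
  ... | inj₂ 1-e≤e = inj₁ λ x≡0 → 1≰0 (subst₂ _≤_ (1-e≡1 x≡0) (e≡0 x≡0) 1-e≤e)
    where
    e≡0 : x ≡ 0# → x * x ⁻¹ ≡ 0#
    e≡0 x≡0 = trans (cong (λ w → w * w ⁻¹) x≡0) (zeroˡ (0# ⁻¹))
    1-e≡1 : x ≡ 0# → 1# - x * x ⁻¹ ≡ 1#
    1-e≡1 x≡0 = trans (cong (λ w → 1# - w) (e≡0 x≡0))
                      (trans (cong (λ w → 1# + w) -0#≈0#) (+-identityʳ 1#))

  ≢⊎¬≢ : ∀ (x y : Carrier) → x ≢ y ⊎ ¬ x ≢ y
  ≢⊎¬≢ x y with ≢0⊎¬≢0 (x - y)
  ... | inj₁ x-y≢0  = inj₁ λ x≡y → x-y≢0 (trans (cong (λ w → x - w) (sym x≡y)) (-‿inverseʳ x))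
  ... | inj₂ ¬x-y≢0 = inj₂ λ x≢y → ¬x-y≢0 λ x-y≡0 → x≢y (x∙y⁻¹≈ε⇒x≈y x y x-y≡0)

  SameSign : Carrier → Carrier → Set
  SameSign x y = (0# ≤ x × 0# ≤ y) ⊎ (x ≤ 0# × y ≤ 0#)

  sign-pigeonhole : ∀ x y z → SameSign x y ⊎ SameSign y z ⊎ SameSign x z
  sign-pigeonhole x y z with total 0# x | total 0# y | total 0# z
  ... | inj₁ 0≤x | inj₁ 0≤y | _        = inj₁ (inj₁ (0≤x , 0≤y))
  ... | inj₂ x≤0 | inj₂ y≤0 | _        = inj₁ (inj₂ (x≤0 , y≤0))
  ... | inj₁ 0≤x | inj₂ _   | inj₁ 0≤z = inj₂ (inj₂ (inj₁ (0≤x , 0≤z)))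
  ... | inj₁ _   | inj₂ y≤0 | inj₂ z≤0 = inj₂ (inj₁ (inj₂ (y≤0 , z≤0)))
  ... | inj₂ _   | inj₁ 0≤y | inj₁ 0≤z = inj₂ (inj₁ (inj₁ (0≤y , 0≤z)))
  ... | inj₂ x≤0 | inj₁ _   | inj₂ z≤0 = inj₂ (inj₂ (inj₂ (x≤0 , z≤0)))

  -- Interpolating between two nonzero nonnegative values never hits 0:
  -- x + t (y - x) = (1 - t) x + t y is a sum of nonnegative terms, and if
  -- both vanish then 1 - t = 0 = t.
  nonneg-interpolant≢0 : ∀ {x y t} → x ≢ 0# → y ≢ 0# → 0# ≤ x → 0# ≤ y →
    0# ≤ t → t ≤ 1# → x + t * (y - x) ≢ 0#
  nonneg-interpolant≢0 {x} {y} {t} x≢0 y≢0 0≤x 0≤y 0≤t t≤1 interpolant≡0 = 0≢1 (sym 1≡0)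
    where
    0≤[1-t]x : 0# ≤ (1# - t) * x
    0≤[1-t]x = *-nonneg _ _ (x≤y⇒0≤y-x t≤1) 0≤x
    0≤ty : 0# ≤ t * y
    0≤ty = *-nonneg _ _ 0≤t 0≤y
    convex-sum≡0 : (1# - t) * x + t * y ≡ 0#
    convex-sum≡0 = trans (solve 3 (λ x y t → (con (+ 1) :- t) :* x :+ t :* y := x :+ t :* (y :- x))
                                  refl x y t)
                         interpolant≡0
    1-t≡0 : 1# - t ≡ 0#
    1-t≡0 = no-zero-divisors (nonneg-sum≡0 0≤[1-t]x 0≤ty convex-sum≡0) x≢0
    t≡0 : t ≡ 0#
    t≡0 = no-zero-divisors (nonneg-sum≡0 0≤ty 0≤[1-t]x (trans (+-comm _ _) convex-sum≡0)) y≢0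
    1≡0 : 1# ≡ 0#
    1≡0 = begin
      1#              ≡⟨ solve 1 (λ t → con (+ 1) := (con (+ 1) :- t) :+ t) refl t ⟩
      (1# - t) + t    ≡⟨ cong₂ _+_ 1-t≡0 t≡0 ⟩
      0# + 0#         ≡⟨ +-identityʳ 0# ⟩
      0#              ∎

  interpolant≢0 : ∀ {x y t} → x ≢ 0# → y ≢ 0# → SameSign x y →
    0# ≤ t → t ≤ 1# → x + t * (y - x) ≢ 0#
  interpolant≢0 x≢0 y≢0 (inj₁ (0≤x , 0≤y)) = nonneg-interpolant≢0 x≢0 y≢0 0≤x 0≤y
  interpolant≢0 {x} {y} {t} x≢0 y≢0 (inj₂ (x≤0 , y≤0)) 0≤t t≤1 interpolant≡0 =
    nonneg-interpolant≢0 (-‿≢0 x≢0) (-‿≢0 y≢0) (x≤0⇒0≤-x x≤0) (x≤0⇒0≤-x y≤0) 0≤t t≤1 (begin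
      - x + t * (- y - - x)   ≡⟨ solve 3 (λ x y t → :- x :+ t :* (:- y :- :- x) := :- (x :+ t :* (y :- x)))
                                        refl x y t ⟩
      - (x + t * (y - x))     ≡⟨ cong -_ interpolant≡0 ⟩
      - 0#                    ≡⟨ -0#≈0# ⟩
      0#                      ∎)
    where
    -‿≢0 : ∀ {z} → z ≢ 0# → - z ≢ 0#
    -‿≢0 {z} z≢0 -z≡0 = z≢0 (trans (sym (-‿involutive z)) (trans (cong -_ -z≡0) -0#≈0#))

module Orientation (F : OrderedField) where
  open OrderedField F
  open Plane F
  open OrderedFieldFacts F
  open import Relation.Binary.PropositionalEquality
    using (_≡_; _≢_; refl; cong; cong₂; module ≡-Reasoning)
  open ≡-Reasoning
  open import Data.Integer using (+_)

  -- twice the signed area of the triangle abz; Collinear a b z is, by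
  -- definition, orient a b z ≡ 0#
  orient : Point → Point → Point → Carrier
  orient a b z = (x-coord b - x-coord a) * (y-coord z - y-coord a)
               - (y-coord b - y-coord a) * (x-coord z - x-coord a)

  interpolate : Point → Point → Carrier → Point
  interpolate (cx , cy) (dx , dy) t = cx + t * (dx - cx) , cy + t * (dy - cy)

  on-segment : ∀ {c d z} → (z∈cd : OnSegment c d z) → z ≡ interpolate c d (proj₁ z∈cd)
  on-segment {z = zx , zy} (t , _ , _ , zx≡ , zy≡) = cong₂ _,_ zx≡ zy≡

  orient-on-line : ∀ a b t → orient a b (interpolate a b t) ≡ 0#
  orient-on-line (ax , ay) (bx , by) = solve 5 (λ ax ay bx by t →
      (bx :- ax) :* ((ay :+ t :* (by :- ay)) :- ay) :- (by :- ay) :* ((ax :+ t :* (bx :- ax)) :- ax)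
    := con (+ 0)) refl ax ay bx by

  orient-affine : ∀ a b c d t →
    orient a b (interpolate c d t) ≡ orient a b c + t * (orient a b d - orient a b c)
  orient-affine (ax , ay) (bx , by) (cx , cy) (dx , dy) = solve 9 (λ ax ay bx by cx cy dx dy t →
      (bx :- ax) :* ((cy :+ t :* (dy :- cy)) :- ay) :- (by :- ay) :* ((cx :+ t :* (dx :- cx)) :- ax)
    := (bx :- ax) :* (cy :- ay) :- (by :- ay) :* (cx :- ax)
       :+ t :* (((bx :- ax) :* (dy :- ay) :- (by :- ay) :* (dx :- ax))
               :- ((bx :- ax) :* (cy :- ay) :- (by :- ay) :* (cx :- ax))))
    refl ax ay bx by cx cy dx dy

  -- if c and d lie strictly on the same side of the line ab, the closed
  -- segments [a,b] and [c,d] are disjoint: along [c,d], orient a b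
  -- interpolates between two nonzero values of the same sign, while it
  -- vanishes on [a,b]
  same-side⇒disjoint : ∀ a b c d → orient a b c ≢ 0# → orient a b d ≢ 0# →
    SameSign (orient a b c) (orient a b d) → Disjoint (a , b) (c , d)
  same-side⇒disjoint a b c d c≢0 d≢0 same z z∈ab z∈cd@(t , 0≤t , t≤1 , _) =
    interpolant≢0 c≢0 d≢0 same 0≤t t≤1 (begin
      orient a b c + t * (orient a b d - orient a b c)   ≡⟨ orient-affine a b c d t ⟨
      orient a b (interpolate c d t)                     ≡⟨ cong (orient a b) (on-segment z∈cd) ⟨
      orient a b z                                       ≡⟨ cong (orient a b) (on-segment z∈ab) ⟩
      orient a b (interpolate a b _)                     ≡⟨ orient-on-line a b _ ⟩
      0#                                                 ∎)

  misses-a-side : ∀ a b p q r → orient a b p ≢ 0# → orient a b q ≢ 0# → orient a b r ≢ 0# →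
    ∃ λ f → f ∈ (p , q) ∷ (q , r) ∷ (p , r) ∷ [] × Disjoint (a , b) f
  misses-a-side a b p q r p≢0 q≢0 r≢0
    with sign-pigeonhole (orient a b p) (orient a b q) (orient a b r)
  ... | inj₁ same        = (p , q) , here refl , same-side⇒disjoint a b p q p≢0 q≢0 same
  ... | inj₂ (inj₁ same) = (q , r) , there (here refl) , same-side⇒disjoint a b q r q≢0 r≢0 same
  ... | inj₂ (inj₂ same) = (p , r) , there (there (here refl)) , same-side⇒disjoint a b p r p≢0 r≢0 same

  point-≢⊎¬≢ : ∀ (p q : Point) → p ≢ q ⊎ ¬ p ≢ q
  point-≢⊎¬≢ (px , py) (qx , qy) with ≢⊎¬≢ px qx | ≢⊎¬≢ py qy
  ... | inj₁ px≢qx | _          = inj₁ λ p≡q → px≢qx (cong x-coord p≡q)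
  ... | inj₂ _     | inj₁ py≢qy = inj₁ λ p≡q → py≢qy (cong y-coord p≡q)
  ... | inj₂ ¬px≢qx | inj₂ ¬py≢qy =
    inj₂ λ p≢q → ¬px≢qx λ px≡qx → ¬py≢qy λ py≡qy → p≢q (cong₂ _,_ px≡qx py≡qy)

  ∉⊎¬∉ : ∀ x (ws : List Point) → x ∉ ws ⊎ ¬ x ∉ ws
  ∉⊎¬∉ x [] = inj₁ λ ()
  ∉⊎¬∉ x (w ∷ ws) with point-≢⊎¬≢ x w | ∉⊎¬∉ x ws
  ... | inj₂ ¬x≢w | _         = inj₂ λ x∉ → ¬x≢w λ x≡w → x∉ (here x≡w)
  ... | inj₁ _    | inj₂ ¬x∉ws = inj₂ λ x∉ → ¬x∉ws λ x∈ws → x∉ (there x∈ws)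
  ... | inj₁ x≢w  | inj₁ x∉ws  = inj₁ λ where
    (here x≡w)   → x≢w x≡w
    (there x∈ws) → x∉ws x∈ws

module TwoTriangles (F : OrderedField) (V : Plane.Point F → Set)
                    (general : Plane.GeneralPosition F V) where
  open Plane F
  open Orientation F
  open Triangle using (vertices; edges)
  open import Relation.Binary.PropositionalEquality using (_≢_; refl; sym; subst)

  edge-endpoints : ∀ (T : Triangle V) {x y} → (x , y) ∈ edges T → V x × V y × x ≢ y
  edge-endpoints (triangle _ _ _ a∈V b∈V _   a≢b _   _  ) (here refl)                 = a∈V , b∈V , a≢b
  edge-endpoints (triangle _ _ _ _   b∈V c∈V _   b≢c _  ) (there (here refl))         = b∈V , c∈V , b≢c
  edge-endpoints (triangle _ _ _ a∈V _   c∈V _   _   a≢c) (there (there (here refl))) = a∈V , c∈V , a≢c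

  not-both-shared : ∀ (T₁ T₂ : Triangle V) → ShareAtMostOneVertex T₁ T₂ →
    ∀ {x y} → x ∈ vertices T₁ → y ∈ vertices T₁ → x ≢ y →
    ¬ x ∉ vertices T₂ → ¬ y ∉ vertices T₂ → ⊥
  not-both-shared _ _ share x∈T₁ y∈T₁ x≢y ¬x∉T₂ ¬y∉T₂ =
    ¬x∉T₂ λ x∈T₂ → ¬y∉T₂ λ y∈T₂ → x≢y (share _ _ x∈T₁ x∈T₂ y∈T₁ y∈T₂)

  unshared-edge : ∀ (T₁ T₂ : Triangle V) → ShareAtMostOneVertex T₁ T₂ →
    ∃₂ λ x y → (x , y) ∈ edges T₁ × x ∉ vertices T₂ × y ∉ vertices T₂
  unshared-edge T₁@(triangle a b c _ _ _ a≢b b≢c a≢c) T₂ share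
    with ∉⊎¬∉ a (vertices T₂) | ∉⊎¬∉ b (vertices T₂) | ∉⊎¬∉ c (vertices T₂)
  ... | inj₁ a∉ | inj₁ b∉ | _       = a , b , here refl , a∉ , b∉
  ... | inj₁ a∉ | inj₂ _  | inj₁ c∉ = a , c , there (there (here refl)) , a∉ , c∉
  ... | inj₂ _  | inj₁ b∉ | inj₁ c∉ = b , c , there (here refl) , b∉ , c∉
  ... | inj₁ _  | inj₂ ¬b∉ | inj₂ ¬c∉ =
    ⊥-elim (not-both-shared T₁ T₂ share (there (here refl)) (there (there (here refl))) b≢c ¬b∉ ¬c∉)
  ... | inj₂ ¬a∉ | inj₂ ¬b∉ | _ =
    ⊥-elim (not-both-shared T₁ T₂ share (here refl) (there (here refl)) a≢b ¬a∉ ¬b∉)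
  ... | inj₂ ¬a∉ | inj₁ _ | inj₂ ¬c∉ =
    ⊥-elim (not-both-shared T₁ T₂ share (here refl) (there (there (here refl))) a≢c ¬a∉ ¬c∉)

  misses-an-edge : ∀ (T : Triangle V) {x y} → V x → V y → x ≢ y →
    x ∉ vertices T → y ∉ vertices T → ∃ λ f → f ∈ edges T × Disjoint (x , y) f
  misses-an-edge T@(triangle p q r p∈V q∈V r∈V _ _ _) {x} {y} x∈V y∈V x≢y x∉T y∉T =
    misses-a-side x y p q r (off-line p∈V (here refl)) (off-line q∈V (there (here refl)))
                            (off-line r∈V (there (there (here refl))))
    where
    off-line : ∀ {w} → V w → w ∈ vertices T → ¬ Collinear x y w
    off-line {w} w∈V w∈T = general x y w x∈V y∈V w∈V x≢y
      (λ y≡w → y∉T (subst (_∈ vertices T) (sym y≡w) w∈T))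
      (λ x≡w → x∉T (subst (_∈ vertices T) (sym x≡w) w∈T))

lemma7p2 : (F : OrderedField) → let open Plane F in
    (V : Point → Set) → GeneralPosition V →
    (T₁ T₂ : Triangle V) → ShareAtMostOneVertex T₁ T₂ →
    ∃₂ λ e f → (e ∈ Triangle.edges T₁ ++ Triangle.edges T₂) ×
    (f ∈ Triangle.edges T₁ ++ Triangle.edges T₂) × Disjoint e f
lemma7p2 F V general T₁ T₂ share =
  let open Plane F
      open TwoTriangles F V general
      x , y , xy∈T₁ , x∉T₂ , y∉T₂ = unshared-edge T₁ T₂ share
      x∈V , y∈V , x≢y            = edge-endpoints T₁ xy∈T₁
      f , f∈T₂ , xy-misses-f       = misses-an-edge T₂ x∈V y∈V x≢y x∉T₂ y∉T₂
  in (x , y) , f , ∈-++⁺ˡ xy∈T₁ , ∈-++⁺ʳ (Triangle.edges T₁) f∈T₂ , xy-misses-f
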